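{- Let $M$ be a matroid with blocks $B_1,\dots,B_t$. With the convention $d_0=0$, for every $i$ with $1\le i\le |E(M)|-\operatorname{rk}(M)$, \[d_i(M)=\min\Big\{\sum_{j=1}^t d_{k_j}(B_j): \sum_{j=1}^t k_j=i\Big\},\] where the minimum ranges over tuples $(k_1,\dots,k_t)$ of nonnegative integers with $0\le k_j\le |B_j|-\operatorname{rk}(B_j)$.
   Context: For a matroid $N$ with rank function $\operatorname{rk}$, the $i$-th higher weight is $d_i(N)=\min\{|\tau|:\tau\subset E(N),\ |\tau|-\operatorname{rk}(\tau)=i\}$. The blocks of $M$ are the equivalence classes of the relation on $E(M)$ where $e\sim f$ iff $e=f$ or some circuit of $M$ contains both $e$ and $f$; each block $B$ is regarded as the restriction matroid of $M$ to $B$. -}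

module Defs where

open import Data.Nat using (ℕ; _+_; _∸_; _≤_; _<_)
open import Data.Fin using (Fin; _≟_)
open import Data.Fin.Subset using (Subset; _⊆_; _⊂_; _∈_; _∪_; _∩_; ∣_∣; ⊤)
open import Data.Vec using (tabulate; sum)
open import Data.Product using (Σ; ∃; _×_)
open import Data.Sum using (_⊎_)
open import Function using (Surjective)
open import Relation.Binary.PropositionalEquality using (_≡_)
open import Relation.Nullary.Decidable using (⌊_⌋)

record Matroid (n : ℕ) : Set where
  field
    rk        : Subset n → ℕ
    rk-bound  : ∀ X → rk X ≤ ∣ X ∣
    rk-mono   : ∀ X Y → X ⊆ Y → rk X ≤ rk Y
    rk-submod : ∀ X Y → rk (X ∪ Y) + rk (X ∩ Y) ≤ rk X + rk Y

module _ {n : ℕ} (M : Matroid n) where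
  open Matroid M

  -- |X| - rk(X)  (nullity; truncated subtraction is exact by rk-bound)
  nullity : Subset n → ℕ
  nullity X = ∣ X ∣ ∸ rk X

  IsCircuit : Subset n → Set
  IsCircuit C = rk C < ∣ C ∣ × (∀ D → D ⊂ C → rk D ≡ ∣ D ∣)

  BlockRel : Fin n → Fin n → Set
  BlockRel e f = e ≡ f ⊎ Σ (Subset n) (λ C → IsCircuit C × e ∈ C × f ∈ C)

  -- d_i of the restriction M|S is w: w is the minimum of |τ| over τ ⊆ S
  -- with |τ| - rk(τ) = i (the rank of M|S is the restriction of rk).
  IsHigherWeight : Subset n → ℕ → ℕ → Set
  IsHigherWeight S i w =
    Σ (Subset n) (λ τ → τ ⊆ S × nullity τ ≡ i × ∣ τ ∣ ≡ w)
    × (∀ τ → τ ⊆ S → nullity τ ≡ i → w ≤ ∣ τ ∣)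

-- A labelling of the blocks of M by Fin t: blk e ≡ blk f iff e ∼ f,
-- and every label is used (so B_1,…,B_t are exactly the blocks).
record Blocks {n : ℕ} (M : Matroid n) (t : ℕ) : Set where
  field
    blk      : Fin n → Fin t
    blk-surj : Surjective _≡_ _≡_ blk
    blk-rel  : ∀ e f → (blk e ≡ blk f → BlockRel M e f) × (BlockRel M e f → blk e ≡ blk f)

  block : Fin t → Subset n
  block j = tabulate (λ e → ⌊ blk e ≟ j ⌋)

IsMinimum : (ℕ → Set) → ℕ → Set
IsMinimum V w = V w × (∀ v → V v → w ≤ v)

∑ : {t : ℕ} → (Fin t → ℕ) → ℕ
∑ f = sum (tabulate f)

-- The blocks of a matroid are separators: every circuit lies inside one block,
-- so adding an element e to a set Y raises the rank of Y exactly when it raises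
-- the rank of the part of Y in the block of e (if e is spanned by Y, a circuit
-- through e inside Y ∪ {e} also witnesses that e is spanned by that part).
-- Hence rank, cardinality and nullity are additive over the blocks. A set τ with
-- nullity i then splits into the pieces τ ∩ B_j of nullities k_j summing to i,
-- each of size at least d_{k_j}(B_j); conversely optimal pieces for any such
-- (k_j) glue to a set of nullity i and size Σ d_{k_j}(B_j).
module Submission where

open import Defs
open import Data.Bool using (Bool; true; false)
open import Data.Bool.Properties using (T-≡)
open import Data.Fin using (Fin; zero; suc) renaming (_≟_ to _≟ᶠ_)
open import Data.Fin.Properties using (suc-injective)
open import Data.Fin.Subset
  using (Subset; _∈_; _∉_; _⊆_; _⊂_; _∪_; _∩_; _─_; _-_; ⁅_⁆; ∣_∣; ⊤; ⊥; Nonempty)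
open import Data.Fin.Subset.Properties
  using ( _∈?_; _⊆?_; anySubset?; nonempty?; Empty-unique; ∣⊥∣≡0; ∣⁅x⁆∣≡1; x∈⁅x⁆; x∈⁅y⁆⇒x≡y
        ; ⊆-refl; ⊆-antisym; ⊆-trans; ⊆⊤; drop-∷-⊆; p⊂q⇒∣p∣<∣q∣; x∈p⇒p-x⊂p
        ; x∈p⇒∣p-x∣<∣p∣; x∈p∧x≢y⇒x∈p-y; x∈p∧x∉q⇒x∈p─q; p─q⊆p; p⊆p∪q
        ; x∈p∪q⁺; x∈p∪q⁻; x∈p∩q⁺; x∈p∩q⁻; p∩q⊆p; p∩q⊆q
        ; ∪-identityʳ; ∩-zeroˡ; ∩-distribʳ-∪ )
open import Data.Nat using (ℕ; zero; suc; _+_; _∸_; _≤_; _<_; z≤n; s≤s; _≟_; _<?_; _≤?_)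
open import Data.Nat.Properties hiding (suc-injective)
open import Data.Nat.Tactic.RingSolver using (solve-∀)
open import Data.Product using (Σ; Σ-syntax; _×_; _,_; proj₁; proj₂)
open import Data.Sum using (_⊎_; inj₁; inj₂)
open import Data.Vec using ([]; _∷_; here; there; tabulate; lookup)
open import Data.Vec.Properties using (lookup∘tabulate; []=⇒lookup; lookup⇒[]=)
open import Function using (_∘_)
open import Function.Bundles using (Equivalence)
open import Relation.Binary.PropositionalEquality
open import Relation.Nullary using (¬_; yes; no; contradiction)
open import Relation.Nullary.Decidable using (_×-dec_; toWitness; fromWitness)
open import Relation.Unary using (Decidable)

private
  variable
    n : ℕ

-- Finite subsets

x∉p-x : ∀ (p : Subset n) x → x ∉ p - x
x∉p-x (_ ∷ p) zero ()
x∉p-x (_ ∷ p) (suc x) (there x∈) = x∉p-x p x x∈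

x∈p-y⇒x≢y : ∀ {p : Subset n} {x y} → x ∈ p - y → x ≢ y
x∈p-y⇒x≢y {p = p} {x} x∈ refl = x∉p-x p x x∈

x∈p∪⁅y⁆⁻ : ∀ {p : Subset n} {x y} → x ∈ p ∪ ⁅ y ⁆ → x ∈ p ⊎ x ≡ y
x∈p∪⁅y⁆⁻ {p = p} {y = y} x∈ with x∈p∪q⁻ p ⁅ y ⁆ x∈
... | inj₁ x∈p = inj₁ x∈p
... | inj₂ x∈y = inj₂ (x∈⁅y⁆⇒x≡y y x∈y)

y∈p∪⁅y⁆ : ∀ {p : Subset n} y → y ∈ p ∪ ⁅ y ⁆
y∈p∪⁅y⁆ y = x∈p∪q⁺ (inj₂ (x∈⁅x⁆ y))

p⊆q⇒p∪⁅x⁆⊆q∪⁅x⁆ : ∀ {p q : Subset n} {x} → p ⊆ q → p ∪ ⁅ x ⁆ ⊆ q ∪ ⁅ x ⁆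
p⊆q⇒p∪⁅x⁆⊆q∪⁅x⁆ {x = x} p⊆q y∈ with x∈p∪⁅y⁆⁻ y∈
... | inj₁ y∈p = x∈p∪q⁺ (inj₁ (p⊆q y∈p))
... | inj₂ refl = y∈p∪⁅y⁆ x

p⊆q∪⁅x⁆⇒p-x⊆q : ∀ {p q : Subset n} {x} → p ⊆ q ∪ ⁅ x ⁆ → p - x ⊆ q
p⊆q∪⁅x⁆⇒p-x⊆q {p = p} {x = x} p⊆ y∈ with x∈p∪⁅y⁆⁻ (p⊆ (p─q⊆p p ⁅ x ⁆ y∈))
... | inj₁ y∈q = y∈q
... | inj₂ refl = contradiction refl (x∈p-y⇒x≢y y∈)

∣p∪⁅x⁆∣≡1+∣p∣ : ∀ {p : Subset n} {x} → x ∉ p → ∣ p ∪ ⁅ x ⁆ ∣ ≡ suc ∣ p ∣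
∣p∪⁅x⁆∣≡1+∣p∣ {p = true  ∷ p} {zero}  x∉ = contradiction here x∉
∣p∪⁅x⁆∣≡1+∣p∣ {p = false ∷ p} {zero}  _  = cong (suc ∘ ∣_∣) (∪-identityʳ p)
∣p∪⁅x⁆∣≡1+∣p∣ {p = true  ∷ p} {suc x} x∉ = cong suc (∣p∪⁅x⁆∣≡1+∣p∣ (x∉ ∘ there))
∣p∪⁅x⁆∣≡1+∣p∣ {p = false ∷ p} {suc x} x∉ = ∣p∪⁅x⁆∣≡1+∣p∣ (x∉ ∘ there)

∣q─p∣+∣p∣≡∣q∣ : ∀ {p q : Subset n} → p ⊆ q → ∣ q ─ p ∣ + ∣ p ∣ ≡ ∣ q ∣
∣q─p∣+∣p∣≡∣q∣ {p = []} {[]} _ = refl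
∣q─p∣+∣p∣≡∣q∣ {p = true ∷ p} {true ∷ q} p⊆q =
  trans (+-suc _ _) (cong suc (∣q─p∣+∣p∣≡∣q∣ (drop-∷-⊆ p⊆q)))
∣q─p∣+∣p∣≡∣q∣ {p = true ∷ p} {false ∷ q} p⊆q with p⊆q here
... | ()
∣q─p∣+∣p∣≡∣q∣ {p = false ∷ p} {true ∷ q} p⊆q = cong suc (∣q─p∣+∣p∣≡∣q∣ (drop-∷-⊆ p⊆q))
∣q─p∣+∣p∣≡∣q∣ {p = false ∷ p} {false ∷ q} p⊆q = ∣q─p∣+∣p∣≡∣q∣ (drop-∷-⊆ p⊆q)

p-x∪⁅x⁆≡p : ∀ {p : Subset n} {x} → x ∈ p → (p - x) ∪ ⁅ x ⁆ ≡ p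
p-x∪⁅x⁆≡p {p = p} {x} x∈p = ⊆-antisym ⊆p p⊆
  where
  ⊆p : (p - x) ∪ ⁅ x ⁆ ⊆ p
  ⊆p y∈ with x∈p∪⁅y⁆⁻ y∈
  ... | inj₁ y∈p-x = p─q⊆p p ⁅ x ⁆ y∈p-x
  ... | inj₂ refl  = x∈p
  p⊆ : p ⊆ (p - x) ∪ ⁅ x ⁆
  p⊆ {y} y∈p with y ≟ᶠ x
  ... | yes refl = y∈p∪⁅y⁆ x
  ... | no  y≢x  = x∈p∪q⁺ (inj₁ (x∈p∧x≢y⇒x∈p-y y∈p y≢x))

∣p∣≡1+∣p-x∣ : ∀ {p : Subset n} {x} → x ∈ p → ∣ p ∣ ≡ suc ∣ p - x ∣
∣p∣≡1+∣p-x∣ {p = p} {x} x∈p =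
  trans (cong ∣_∣ (sym (p-x∪⁅x⁆≡p x∈p))) (∣p∪⁅x⁆∣≡1+∣p∣ (x∉p-x p x))

⁅x⁆∩p≡⁅x⁆ : ∀ {p : Subset n} {x} → x ∈ p → ⁅ x ⁆ ∩ p ≡ ⁅ x ⁆
⁅x⁆∩p≡⁅x⁆ {p = p} {x} x∈p =
  ⊆-antisym (p∩q⊆p ⁅ x ⁆ p) λ y∈ → x∈p∩q⁺ (y∈ , subst (_∈ p) (sym (x∈⁅y⁆⇒x≡y x y∈)) x∈p)

⁅x⁆∩p≡⊥ : ∀ {p : Subset n} {x} → x ∉ p → ⁅ x ⁆ ∩ p ≡ ⊥
⁅x⁆∩p≡⊥ {p = p} {x} x∉p = Empty-unique λ (y , y∈) →
  let (y∈x , y∈p) = x∈p∩q⁻ ⁅ x ⁆ p y∈ in x∉p (subst (_∈ p) (x∈⁅y⁆⇒x≡y x y∈x) y∈p)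

0<∣p∣⇒Nonempty : ∀ {p : Subset n} → 0 < ∣ p ∣ → Nonempty p
0<∣p∣⇒Nonempty {n} {p} 0<∣p∣ with nonempty? p
... | yes ne = ne
... | no  ¬ne = contradiction (trans (cong ∣_∣ (Empty-unique ¬ne)) (∣⊥∣≡0 n)) (>⇒≢ 0<∣p∣)

∈-tabulate⁺ : ∀ {f : Fin n → Bool} {x} → f x ≡ true → x ∈ tabulate f
∈-tabulate⁺ {f = f} {x} fx = lookup⇒[]= x (tabulate f) (trans (lookup∘tabulate f x) fx)

∈-tabulate⁻ : ∀ {f : Fin n → Bool} {x} → x ∈ tabulate f → f x ≡ true
∈-tabulate⁻ {f = f} {x} x∈ = trans (sym (lookup∘tabulate f x)) ([]=⇒lookup x∈)

insertion-induction : ∀ {n} (P : Subset n → Set) → P ⊥ →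
  (∀ {Y x} → x ∉ Y → P Y → P (Y ∪ ⁅ x ⁆)) → ∀ X → P X
insertion-induction P P⊥ step X = go ∣ X ∣ X ≤-refl
  where
  go : ∀ m X → ∣ X ∣ ≤ m → P X
  go m X ∣X∣≤m with nonempty? X
  ... | no empty = subst P (sym (Empty-unique empty)) P⊥
  go zero X ∣X∣≤0 | yes (x , x∈X) = contradiction (≤-trans (x∈p⇒∣p-x∣<∣p∣ x∈X) ∣X∣≤0) (λ ())
  go (suc m) X ∣X∣≤1+m | yes (x , x∈X) =
    subst P (p-x∪⁅x⁆≡p x∈X)
      (step (x∉p-x X x) (go m (X - x) (≤-pred (≤-trans (x∈p⇒∣p-x∣<∣p∣ x∈X) ∣X∣≤1+m))))

minimal-subset : ∀ {n} {P : Subset n → Set} → Decidable P → ∀ {X} → P X →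
  Σ[ Y ∈ Subset n ] P Y × (∀ Z → P Z → ∣ Y ∣ ≤ ∣ Z ∣)
minimal-subset {n} {P} P? {X} PX = go ∣ X ∣ X ≤-refl PX
  where
  go : ∀ m X → ∣ X ∣ ≤ m → P X → Σ[ Y ∈ Subset n ] P Y × (∀ Z → P Z → ∣ Y ∣ ≤ ∣ Z ∣)
  go m X ∣X∣≤m PX with anySubset? (λ Z → P? Z ×-dec (∣ Z ∣ <? ∣ X ∣))
  ... | no none = X , PX , λ Z PZ → ≮⇒≥ (λ ∣Z∣<∣X∣ → none (Z , PZ , ∣Z∣<∣X∣))
  go zero X ∣X∣≤0 PX | yes (Z , _ , ∣Z∣<∣X∣) = contradiction (≤-trans ∣Z∣<∣X∣ ∣X∣≤0) (λ ())
  go (suc m) X ∣X∣≤1+m PX | yes (Z , PZ , ∣Z∣<∣X∣) = go m Z (≤-pred (≤-trans ∣Z∣<∣X∣ ∣X∣≤1+m)) PZ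

-- Sums over Fin t

∑-cong : ∀ {t} {f g : Fin t → ℕ} → (∀ j → f j ≡ g j) → ∑ f ≡ ∑ g
∑-cong {zero}  f≡g = refl
∑-cong {suc t} f≡g = cong₂ _+_ (f≡g zero) (∑-cong (f≡g ∘ suc))

∑-mono-≤ : ∀ {t} {f g : Fin t → ℕ} → (∀ j → f j ≤ g j) → ∑ f ≤ ∑ g
∑-mono-≤ {zero}  f≤g = z≤n
∑-mono-≤ {suc t} f≤g = +-mono-≤ (f≤g zero) (∑-mono-≤ (f≤g ∘ suc))

∑-distrib-+ : ∀ {t} (f g : Fin t → ℕ) → ∑ (λ j → f j + g j) ≡ ∑ f + ∑ g
∑-distrib-+ {zero}  f g = refl
∑-distrib-+ {suc t} f g =
  trans (cong (f zero + g zero +_) (∑-distrib-+ (f ∘ suc) (g ∘ suc)))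
        (interchange (f zero) (g zero) (∑ (f ∘ suc)) (∑ (g ∘ suc)))
  where
  interchange : ∀ a b c d → a + b + (c + d) ≡ a + c + (b + d)
  interchange = solve-∀

∑-zero : ∀ {t} {f : Fin t → ℕ} → (∀ j → f j ≡ 0) → ∑ f ≡ 0
∑-zero {zero}  f≡0 = refl
∑-zero {suc t} f≡0 = cong₂ _+_ (f≡0 zero) (∑-zero (f≡0 ∘ suc))

∑-agree-except : ∀ {t} {f g : Fin t → ℕ} j₀ → (∀ j → j ≢ j₀ → f j ≡ g j) →
  ∑ f + g j₀ ≡ ∑ g + f j₀
∑-agree-except {suc t} {f} {g} zero f≡g =
  trans (cong (λ s → f zero + s + g zero) (∑-cong (λ j → f≡g (suc j) λ ())))
        (swap-ends (f zero) (∑ (g ∘ suc)) (g zero))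
  where
  swap-ends : ∀ a s b → a + s + b ≡ b + s + a
  swap-ends = solve-∀
∑-agree-except {suc t} {f} {g} (suc j₀) f≡g = begin
  f zero + ∑ (f ∘ suc) + g (suc j₀)   ≡⟨ +-assoc (f zero) _ _ ⟩
  f zero + (∑ (f ∘ suc) + g (suc j₀)) ≡⟨ cong₂ _+_ (f≡g zero λ ()) (∑-agree-except j₀ (λ j j≢j₀ → f≡g (suc j) (j≢j₀ ∘ suc-injective))) ⟩
  g zero + (∑ (g ∘ suc) + f (suc j₀)) ≡⟨ +-assoc (g zero) _ _ ⟨
  g zero + ∑ (g ∘ suc) + f (suc j₀)   ∎
  where open ≡-Reasoning

-- Rank and nullity

module MatroidProperties {n : ℕ} (M : Matroid n) where
  open Matroid M

  Independent : Subset n → Set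
  Independent X = rk X ≡ ∣ X ∣

  Dependent : Subset n → Set
  Dependent X = rk X < ∣ X ∣

  ¬Dependent⇒Independent : ∀ {X} → ¬ Dependent X → Independent X
  ¬Dependent⇒Independent {X} ¬dep = ≤-antisym (rk-bound X) (≮⇒≥ ¬dep)

  rk-⊥ : rk ⊥ ≡ 0
  rk-⊥ = n≤0⇒n≡0 (≤-trans (rk-bound ⊥) (≤-reflexive (∣⊥∣≡0 n)))

  rk-insert-≤ : ∀ X e → rk (X ∪ ⁅ e ⁆) ≤ suc (rk X)
  rk-insert-≤ X e = begin
    rk (X ∪ ⁅ e ⁆)                  ≤⟨ m≤m+n _ _ ⟩
    rk (X ∪ ⁅ e ⁆) + rk (X ∩ ⁅ e ⁆) ≤⟨ rk-submod X ⁅ e ⁆ ⟩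
    rk X + rk ⁅ e ⁆                 ≤⟨ +-monoʳ-≤ (rk X) (≤-trans (rk-bound ⁅ e ⁆) (≤-reflexive (∣⁅x⁆∣≡1 e))) ⟩
    rk X + 1                        ≡⟨ +-comm (rk X) 1 ⟩
    suc (rk X)                      ∎
    where open ≤-Reasoning

  rk-insert : ∀ X e → rk (X ∪ ⁅ e ⁆) ≢ rk X → rk (X ∪ ⁅ e ⁆) ≡ suc (rk X)
  rk-insert X e rk≢ =
    ≤-antisym (rk-insert-≤ X e) (≤∧≢⇒< (rk-mono X _ (p⊆p∪q ⁅ e ⁆)) (rk≢ ∘ sym))

  rk-insert-antitone : ∀ {X Y} e → X ⊆ Y → rk (Y ∪ ⁅ e ⁆) + rk X ≤ rk Y + rk (X ∪ ⁅ e ⁆)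
  rk-insert-antitone {X} {Y} e X⊆Y = begin
    rk (Y ∪ ⁅ e ⁆) + rk X                             ≤⟨ +-mono-≤ (rk-mono _ _ Y∪e⊆) (rk-mono _ _ X⊆) ⟩
    rk (Y ∪ (X ∪ ⁅ e ⁆)) + rk (Y ∩ (X ∪ ⁅ e ⁆))       ≤⟨ rk-submod Y (X ∪ ⁅ e ⁆) ⟩
    rk Y + rk (X ∪ ⁅ e ⁆)                             ∎
    where
    open ≤-Reasoning
    Y∪e⊆ : Y ∪ ⁅ e ⁆ ⊆ Y ∪ (X ∪ ⁅ e ⁆)
    Y∪e⊆ x∈ with x∈p∪⁅y⁆⁻ x∈
    ... | inj₁ x∈Y = x∈p∪q⁺ (inj₁ x∈Y)
    ... | inj₂ refl = x∈p∪q⁺ (inj₂ (y∈p∪⁅y⁆ e))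
    X⊆ : X ⊆ Y ∩ (X ∪ ⁅ e ⁆)
    X⊆ x∈X = x∈p∩q⁺ (X⊆Y x∈X , x∈p∪q⁺ (inj₁ x∈X))

  nullity+rk : ∀ X → nullity M X + rk X ≡ ∣ X ∣
  nullity+rk X = m∸n+n≡m (rk-bound X)

  nullity-mono : ∀ {X Y} → X ⊆ Y → nullity M X ≤ nullity M Y
  nullity-mono {X} {Y} X⊆Y = begin
    ∣ X ∣ ∸ rk X                         ≡⟨ [m+n]∸[m+o]≡n∸o r ∣ X ∣ (rk X) ⟨
    (r + ∣ X ∣) ∸ (r + rk X)             ≤⟨ ∸-monoʳ-≤ (r + ∣ X ∣) rk-split ⟩
    (r + ∣ X ∣) ∸ rk Y                   ≡⟨ cong (_∸ rk Y) (∣q─p∣+∣p∣≡∣q∣ X⊆Y) ⟩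
    ∣ Y ∣ ∸ rk Y                         ∎
    where
    open ≤-Reasoning
    r : ℕ
    r = ∣ Y ─ X ∣
    Y⊆ : Y ⊆ (Y ─ X) ∪ X
    Y⊆ {x} x∈Y with x ∈? X
    ... | yes x∈X = x∈p∪q⁺ (inj₂ x∈X)
    ... | no  x∉X = x∈p∪q⁺ (inj₁ (x∈p∧x∉q⇒x∈p─q x∈Y x∉X))
    rk-split : rk Y ≤ r + rk X
    rk-split = begin
      rk Y                                         ≤⟨ rk-mono _ _ Y⊆ ⟩
      rk ((Y ─ X) ∪ X)                             ≤⟨ m≤m+n _ _ ⟩
      rk ((Y ─ X) ∪ X) + rk ((Y ─ X) ∩ X)          ≤⟨ rk-submod (Y ─ X) X ⟩
      rk (Y ─ X) + rk X                            ≤⟨ +-monoˡ-≤ (rk X) (rk-bound (Y ─ X)) ⟩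
      r + rk X                                     ∎

  Independent-⊆ : ∀ {X Y} → X ⊆ Y → Independent Y → Independent X
  Independent-⊆ {X} {Y} X⊆Y indY = ≤-antisym (rk-bound X) (m∸n≡0⇒m≤n (n≤0⇒n≡0 (begin
    nullity M X   ≤⟨ nullity-mono X⊆Y ⟩
    ∣ Y ∣ ∸ rk Y  ≡⟨ cong (∣ Y ∣ ∸_) indY ⟩
    ∣ Y ∣ ∸ ∣ Y ∣ ≡⟨ n∸n≡0 ∣ Y ∣ ⟩
    0             ∎)))
    where open ≤-Reasoning

  nullity-delete : ∀ {X x} → x ∈ X → nullity M X ≤ suc (nullity M (X - x))
  nullity-delete {X} {x} x∈X = begin
    ∣ X ∣ ∸ rk X                     ≡⟨ cong (_∸ rk X) (∣p∣≡1+∣p-x∣ x∈X) ⟩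
    suc ∣ X - x ∣ ∸ rk X             ≤⟨ ∸-monoʳ-≤ (suc ∣ X - x ∣) (rk-mono _ _ (p─q⊆p X ⁅ x ⁆)) ⟩
    suc ∣ X - x ∣ ∸ rk (X - x)       ≡⟨ +-∸-assoc 1 (rk-bound (X - x)) ⟩
    suc (∣ X - x ∣ ∸ rk (X - x))     ∎
    where open ≤-Reasoning

  dependent-contains-circuit : ∀ {X} → Dependent X → Σ[ C ∈ Subset n ] C ⊆ X × IsCircuit M C
  dependent-contains-circuit {X} depX
    with minimal-subset (λ C → (C ⊆? X) ×-dec (rk C <? ∣ C ∣)) (⊆-refl , depX)
  ... | C , (C⊆X , depC) , minimal = C , C⊆X , depC , λ D D⊂C →
    ¬Dependent⇒Independent λ depD →
      <⇒≱ (p⊂q⇒∣p∣<∣q∣ D⊂C) (minimal D (⊆-trans (proj₁ D⊂C) C⊆X , depD))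

  circuit-delete : ∀ {C x} → IsCircuit M C → x ∈ C → rk C ≤ rk (C - x)
  circuit-delete {C} {x} (depC , minimal) x∈C = begin
    rk C       ≤⟨ ≤-pred (≤-trans depC (≤-reflexive (∣p∣≡1+∣p-x∣ x∈C))) ⟩
    ∣ C - x ∣  ≡⟨ minimal (C - x) (x∈p⇒p-x⊂p x∈C) ⟨
    rk (C - x) ∎
    where open ≤-Reasoning

  -- Submodularity for X - x and a circuit C ⊆ X through x.
  dependent⇒redundant : ∀ {X} → Dependent X → Σ[ x ∈ Fin n ] x ∈ X × rk (X - x) ≡ rk X
  dependent⇒redundant {X} depX with dependent-contains-circuit depX
  ... | C , C⊆X , circC@(depC , _) with 0<∣p∣⇒Nonempty (≤-trans (s≤s z≤n) depC)
  ... | x , x∈C =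
    x , C⊆X x∈C , ≤-antisym (rk-mono _ _ (p─q⊆p X ⁅ x ⁆)) (+-cancelʳ-≤ (rk (C - x)) _ _ (begin
    rk X + rk (C - x)                              ≤⟨ +-mono-≤ (rk-mono _ _ X⊆) (rk-mono _ _ C-x⊆) ⟩
    rk ((X - x) ∪ C) + rk ((X - x) ∩ C)            ≤⟨ rk-submod (X - x) C ⟩
    rk (X - x) + rk C                              ≤⟨ +-monoʳ-≤ (rk (X - x)) (circuit-delete circC x∈C) ⟩
    rk (X - x) + rk (C - x)                        ∎))
    where
    open ≤-Reasoning
    X⊆ : X ⊆ (X - x) ∪ C
    X⊆ {y} y∈X with y ≟ᶠ x
    ... | yes refl = x∈p∪q⁺ (inj₂ x∈C)
    ... | no  y≢x  = x∈p∪q⁺ (inj₁ (x∈p∧x≢y⇒x∈p-y y∈X y≢x))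
    C-x⊆ : C - x ⊆ (X - x) ∩ C
    C-x⊆ y∈ = let y∈C = p─q⊆p C ⁅ x ⁆ y∈ in
      x∈p∩q⁺ (x∈p∧x≢y⇒x∈p-y (C⊆X y∈C) (x∈p-y⇒x≢y y∈) , y∈C)

  circuit-spans : ∀ {C X e} → IsCircuit M C → e ∈ C → C - e ⊆ X → rk (X ∪ ⁅ e ⁆) ≤ rk X
  circuit-spans {C} {X} {e} circC e∈C C-e⊆X = +-cancelʳ-≤ (rk (C - e)) _ _ (begin
    rk (X ∪ ⁅ e ⁆) + rk (C - e)  ≤⟨ rk-insert-antitone e C-e⊆X ⟩
    rk X + rk ((C - e) ∪ ⁅ e ⁆)  ≡⟨ cong (λ Z → rk X + rk Z) (p-x∪⁅x⁆≡p e∈C) ⟩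
    rk X + rk C                  ≤⟨ +-monoʳ-≤ (rk X) (circuit-delete circC e∈C) ⟩
    rk X + rk (C - e)            ∎)
    where open ≤-Reasoning

  insertion-circuit : ∀ {D e} → e ∉ D → Independent D → rk (D ∪ ⁅ e ⁆) ≡ rk D →
    (∀ {x} → x ∈ D → Independent ((D - x) ∪ ⁅ e ⁆)) → IsCircuit M (D ∪ ⁅ e ⁆)
  insertion-circuit {D} {e} e∉D indD spanned indD-x = dependent , proper
    where
    dependent : Dependent (D ∪ ⁅ e ⁆)
    dependent = begin-strict
      rk (D ∪ ⁅ e ⁆) ≡⟨ trans spanned indD ⟩
      ∣ D ∣          <⟨ n<1+n ∣ D ∣ ⟩
      suc ∣ D ∣      ≡⟨ ∣p∪⁅x⁆∣≡1+∣p∣ e∉D ⟨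
      ∣ D ∪ ⁅ e ⁆ ∣  ∎
      where open ≤-Reasoning
    proper : ∀ D′ → D′ ⊂ D ∪ ⁅ e ⁆ → Independent D′
    proper D′ (D′⊆ , x , x∈ , x∉D′) with x∈p∪⁅y⁆⁻ x∈
    ... | inj₂ refl = Independent-⊆ D′⊆D indD
      where
      D′⊆D : D′ ⊆ D
      D′⊆D y∈D′ with x∈p∪⁅y⁆⁻ (D′⊆ y∈D′)
      ... | inj₁ y∈D = y∈D
      ... | inj₂ refl = contradiction y∈D′ x∉D′
    ... | inj₁ x∈D = Independent-⊆ D′⊆D-x∪e (indD-x x∈D)
      where
      D′⊆D-x∪e : D′ ⊆ (D - x) ∪ ⁅ e ⁆
      D′⊆D-x∪e y∈D′ with x∈p∪⁅y⁆⁻ (D′⊆ y∈D′)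
      ... | inj₁ y∈D = x∈p∪q⁺ (inj₁ (x∈p∧x≢y⇒x∈p-y y∈D λ { refl → x∉D′ y∈D′ }))
      ... | inj₂ refl = y∈p∪⁅y⁆ e

  -- A smallest D ⊆ Y whose rank e does not raise gives the circuit D ∪ {e}.
  circuit-through : ∀ {Y e} → e ∉ Y → rk (Y ∪ ⁅ e ⁆) ≡ rk Y →
    Σ[ C ∈ Subset n ] IsCircuit M C × e ∈ C × C ⊆ Y ∪ ⁅ e ⁆
  circuit-through {Y} {e} e∉Y spannedY
    with minimal-subset (λ D → (D ⊆? Y) ×-dec (rk (D ∪ ⁅ e ⁆) ≟ rk D)) (⊆-refl , spannedY)
  ... | D , (D⊆Y , spanned) , minimal =
    D ∪ ⁅ e ⁆ , insertion-circuit e∉D indD spanned indD-x , y∈p∪⁅y⁆ e , p⊆q⇒p∪⁅x⁆⊆q∪⁅x⁆ D⊆Y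
    where
    e∉D : e ∉ D
    e∉D = e∉Y ∘ D⊆Y
    unspanned : ∀ {x} → x ∈ D → rk ((D - x) ∪ ⁅ e ⁆) ≢ rk (D - x)
    unspanned x∈D spanned′ =
      <⇒≱ (x∈p⇒∣p-x∣<∣p∣ x∈D) (minimal _ (⊆-trans (p─q⊆p D _) D⊆Y , spanned′))
    indD : Independent D
    indD = ¬Dependent⇒Independent λ depD →
      let (x , x∈D , rk≡) = dependent⇒redundant depD in
      unspanned x∈D (≤-antisym (begin
        rk ((D - x) ∪ ⁅ e ⁆) ≤⟨ rk-mono _ _ (p⊆q⇒p∪⁅x⁆⊆q∪⁅x⁆ (p─q⊆p D _)) ⟩
        rk (D ∪ ⁅ e ⁆)       ≡⟨ spanned ⟩
        rk D                 ≡⟨ rk≡ ⟨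
        rk (D - x)           ∎) (rk-mono _ _ (p⊆p∪q _)))
      where open ≤-Reasoning
    indD-x : ∀ {x} → x ∈ D → Independent ((D - x) ∪ ⁅ e ⁆)
    indD-x {x} x∈D = begin
      rk ((D - x) ∪ ⁅ e ⁆) ≡⟨ rk-insert _ e (unspanned x∈D) ⟩
      suc (rk (D - x))     ≡⟨ cong suc (Independent-⊆ (p─q⊆p D _) indD) ⟩
      suc ∣ D - x ∣        ≡⟨ ∣p∪⁅x⁆∣≡1+∣p∣ (e∉D ∘ p─q⊆p D _) ⟨
      ∣ (D - x) ∪ ⁅ e ⁆ ∣  ∎
      where open ≡-Reasoning

  rk-insert-separated : ∀ {B Y e} → (∀ {C} → IsCircuit M C → e ∈ C → C ⊆ B) → e ∉ Y →
    rk (Y ∪ ⁅ e ⁆) + rk (Y ∩ B) ≡ rk Y + rk ((Y ∩ B) ∪ ⁅ e ⁆)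
  rk-insert-separated {B} {Y} {e} separated e∉Y with rk (Y ∪ ⁅ e ⁆) ≟ rk Y
  ... | no grows = ≤-antisym (rk-insert-antitone e (p∩q⊆p Y B)) (begin
    rk Y + rk ((Y ∩ B) ∪ ⁅ e ⁆) ≤⟨ +-monoʳ-≤ (rk Y) (rk-insert-≤ (Y ∩ B) e) ⟩
    rk Y + suc (rk (Y ∩ B))     ≡⟨ +-suc (rk Y) _ ⟩
    suc (rk Y) + rk (Y ∩ B)     ≡⟨ cong (_+ rk (Y ∩ B)) (rk-insert Y e grows) ⟨
    rk (Y ∪ ⁅ e ⁆) + rk (Y ∩ B) ∎)
    where open ≤-Reasoning
  ... | yes spanned =
    let (C , circC , e∈C , C⊆) = circuit-through e∉Y spanned
        C-e⊆ : C - e ⊆ Y ∩ B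
        C-e⊆ x∈ = x∈p∩q⁺ (p⊆q∪⁅x⁆⇒p-x⊆q C⊆ x∈ , separated circC e∈C (p─q⊆p C ⁅ e ⁆ x∈))
    in cong₂ _+_ spanned (≤-antisym (rk-mono _ _ (p⊆p∪q ⁅ e ⁆)) (circuit-spans circC e∈C C-e⊆))

  nullity-realised : ∀ {X k} → k ≤ nullity M X → Σ[ τ ∈ Subset n ] τ ⊆ X × nullity M τ ≡ k
  nullity-realised {X} {k} k≤
    with minimal-subset (λ τ → (τ ⊆? X) ×-dec (k ≤? nullity M τ)) (⊆-refl , k≤)
  ... | τ , (τ⊆X , k≤τ) , minimal = τ , τ⊆X , ≤-antisym (≮⇒≥ ¬k<τ) k≤τ
    where
    ¬k<τ : ¬ k < nullity M τ
    ¬k<τ k<τ =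
      let (x , x∈τ) = 0<∣p∣⇒Nonempty (<-≤-trans (≤-<-trans z≤n k<τ) (m∸n≤m ∣ τ ∣ (rk τ))) in
      <⇒≱ (x∈p⇒∣p-x∣<∣p∣ x∈τ)
        (minimal (τ - x) (⊆-trans (p─q⊆p τ _) τ⊆X , ≤-pred (≤-trans k<τ (nullity-delete x∈τ))))

  higherWeight-exists : ∀ {S τ k} → τ ⊆ S → nullity M τ ≡ k → Σ ℕ (IsHigherWeight M S k)
  higherWeight-exists {S} {k = k} τ⊆S nullτ≡k
    with minimal-subset (λ τ → (τ ⊆? S) ×-dec (nullity M τ ≟ k)) (τ⊆S , nullτ≡k)
  ... | τ₀ , (τ₀⊆S , nullτ₀≡k) , minimal =
    ∣ τ₀ ∣ , (τ₀ , τ₀⊆S , nullτ₀≡k , refl) , λ τ τ⊆S nullτ≡k → minimal τ (τ⊆S , nullτ≡k)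

-- Blocks

module BlockProperties {n : ℕ} {M : Matroid n} {t : ℕ} (B : Blocks M t) where
  open Matroid M
  open Blocks B
  open MatroidProperties M

  ∈-block⁺ : ∀ {e j} → blk e ≡ j → e ∈ block j
  ∈-block⁺ blk≡j = ∈-tabulate⁺ (Equivalence.to T-≡ (fromWitness blk≡j))

  ∈-block⁻ : ∀ {e j} → e ∈ block j → blk e ≡ j
  ∈-block⁻ e∈ = toWitness (Equivalence.from T-≡ (∈-tabulate⁻ e∈))

  circuit⊆block : ∀ {C e} → IsCircuit M C → e ∈ C → C ⊆ block (blk e)
  circuit⊆block {C} {e} circC e∈C {f} f∈C =
    ∈-block⁺ (sym (proj₂ (blk-rel e f) (inj₂ (C , circC , e∈C , f∈C))))

  module _ (g : Subset n → ℕ) (g-⊥ : g ⊥ ≡ 0)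
    (g-insert : ∀ {Y e} → e ∉ Y →
      g (Y ∪ ⁅ e ⁆) + g (Y ∩ block (blk e)) ≡ g Y + g ((Y ∩ block (blk e)) ∪ ⁅ e ⁆)) where

    additive : ∀ X → g X ≡ ∑ (λ j → g (X ∩ block j))
    additive = insertion-induction _ base step
      where
      base : g ⊥ ≡ ∑ (λ j → g (⊥ ∩ block j))
      base = trans g-⊥ (sym (∑-zero (λ j → trans (cong g (∩-zeroˡ (block j))) g-⊥)))
      step : ∀ {Y e} → e ∉ Y → g Y ≡ ∑ (λ j → g (Y ∩ block j)) →
        g (Y ∪ ⁅ e ⁆) ≡ ∑ (λ j → g ((Y ∪ ⁅ e ⁆) ∩ block j))
      step {Y} {e} e∉Y ih = +-cancelʳ-≡ (g (Y ∩ block (blk e))) _ _ (begin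
        g (Y ∪ ⁅ e ⁆) + g (Y ∩ block (blk e))                         ≡⟨ g-insert e∉Y ⟩
        g Y + g ((Y ∩ block (blk e)) ∪ ⁅ e ⁆)                         ≡⟨ cong₂ _+_ (sym ih) (cong g slice-here) ⟨
        ∑ (λ j → g (Y ∩ block j)) + g ((Y ∪ ⁅ e ⁆) ∩ block (blk e))   ≡⟨ ∑-agree-except (blk e) (λ j → cong g ∘ slice-away) ⟨
        ∑ (λ j → g ((Y ∪ ⁅ e ⁆) ∩ block j)) + g (Y ∩ block (blk e))   ∎)
        where
        open ≡-Reasoning
        slice : ∀ j → (Y ∪ ⁅ e ⁆) ∩ block j ≡ (Y ∩ block j) ∪ (⁅ e ⁆ ∩ block j)
        slice j = ∩-distribʳ-∪ (block j) Y ⁅ e ⁆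
        slice-here : (Y ∪ ⁅ e ⁆) ∩ block (blk e) ≡ (Y ∩ block (blk e)) ∪ ⁅ e ⁆
        slice-here = trans (slice (blk e)) (cong (Y ∩ block (blk e) ∪_) (⁅x⁆∩p≡⁅x⁆ (∈-block⁺ refl)))
        slice-away : ∀ {j} → j ≢ blk e → (Y ∪ ⁅ e ⁆) ∩ block j ≡ Y ∩ block j
        slice-away {j} j≢ = begin
          (Y ∪ ⁅ e ⁆) ∩ block j              ≡⟨ slice j ⟩
          (Y ∩ block j) ∪ (⁅ e ⁆ ∩ block j)  ≡⟨ cong (Y ∩ block j ∪_) (⁅x⁆∩p≡⊥ (j≢ ∘ sym ∘ ∈-block⁻)) ⟩
          (Y ∩ block j) ∪ ⊥                  ≡⟨ ∪-identityʳ _ ⟩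
          Y ∩ block j                        ∎

  rk-additive : ∀ X → rk X ≡ ∑ (λ j → rk (X ∩ block j))
  rk-additive = additive rk rk-⊥ (rk-insert-separated circuit⊆block)

  card-additive : ∀ X → ∣ X ∣ ≡ ∑ (λ j → ∣ X ∩ block j ∣)
  card-additive = additive ∣_∣ (∣⊥∣≡0 n) card-insert
    where
    card-insert : ∀ {Y e} → e ∉ Y →
      ∣ Y ∪ ⁅ e ⁆ ∣ + ∣ Y ∩ block (blk e) ∣ ≡ ∣ Y ∣ + ∣ (Y ∩ block (blk e)) ∪ ⁅ e ⁆ ∣
    card-insert {Y} {e} e∉Y = begin
      ∣ Y ∪ ⁅ e ⁆ ∣ + ∣ Y ∩ Bₑ ∣      ≡⟨ cong (_+ ∣ Y ∩ Bₑ ∣) (∣p∪⁅x⁆∣≡1+∣p∣ e∉Y) ⟩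
      suc (∣ Y ∣ + ∣ Y ∩ Bₑ ∣)        ≡⟨ +-suc ∣ Y ∣ ∣ Y ∩ Bₑ ∣ ⟨
      ∣ Y ∣ + suc ∣ Y ∩ Bₑ ∣          ≡⟨ cong (∣ Y ∣ +_) (∣p∪⁅x⁆∣≡1+∣p∣ (e∉Y ∘ p∩q⊆p Y Bₑ)) ⟨
      ∣ Y ∣ + ∣ (Y ∩ Bₑ) ∪ ⁅ e ⁆ ∣    ∎
      where
      open ≡-Reasoning
      Bₑ : Subset n
      Bₑ = block (blk e)

  nullity-additive : ∀ X → nullity M X ≡ ∑ (λ j → nullity M (X ∩ block j))
  nullity-additive X = +-cancelʳ-≡ (rk X) _ _ (begin
    nullity M X + rk X                                          ≡⟨ nullity+rk X ⟩
    ∣ X ∣                                                       ≡⟨ card-additive X ⟩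
    ∑ (λ j → ∣ X ∩ block j ∣)                                   ≡⟨ ∑-cong (λ j → nullity+rk (X ∩ block j)) ⟨
    ∑ (λ j → nullity M (X ∩ block j) + rk (X ∩ block j))        ≡⟨ ∑-distrib-+ null-at rk-at ⟩
    ∑ null-at + ∑ rk-at                                         ≡⟨ cong (∑ null-at +_) (rk-additive X) ⟨
    ∑ null-at + rk X                                            ∎)
    where
    open ≡-Reasoning
    null-at rk-at : Fin t → ℕ
    null-at j = nullity M (X ∩ block j)
    rk-at j = rk (X ∩ block j)

  glue : (Fin t → Subset n) → Subset n
  glue τ = tabulate (λ e → lookup (τ (blk e)) e)

  glue-∩-block : ∀ {τ} → (∀ j → τ j ⊆ block j) → ∀ j → glue τ ∩ block j ≡ τ j
  glue-∩-block {τ} τ⊆B j = ⊆-antisym ⊆τ τ⊆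
    where
    ⊆τ : glue τ ∩ block j ⊆ τ j
    ⊆τ {x} x∈ = let (x∈glue , x∈B) = x∈p∩q⁻ (glue τ) (block j) x∈ in
      subst (λ i → x ∈ τ i) (∈-block⁻ x∈B) (lookup⇒[]= x _ (∈-tabulate⁻ x∈glue))
    τ⊆ : τ j ⊆ glue τ ∩ block j
    τ⊆ {x} x∈τ = x∈p∩q⁺ (∈-tabulate⁺ ([]=⇒lookup x∈τ′) , τ⊆B j x∈τ)
      where
      x∈τ′ : x ∈ τ (blk x)
      x∈τ′ = subst (λ i → x ∈ τ i) (sym (∈-block⁻ (τ⊆B j x∈τ))) x∈τ

  Splitting : ℕ → ℕ → Set
  Splitting i v = Σ (Fin t → ℕ) λ k → Σ (Fin t → ℕ) λ dk →
    (∀ j → k j ≤ nullity M (block j)) × ∑ k ≡ i ×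
    (∀ j → IsHigherWeight M (block j) (k j) (dk j)) × v ≡ ∑ dk

  higherWeight≤splitting : ∀ {i w v} → IsHigherWeight M ⊤ i w → Splitting i v → w ≤ v
  higherWeight≤splitting {i} {w} {v} (_ , minimal) (k , dk , _ , ∑k≡i , weights , v≡∑dk) =
    subst (w ≤_) ∣σ∣≡v (minimal σ ⊆⊤ nullσ≡i)
    where
    open ≡-Reasoning
    piece : ∀ j → Σ[ τ ∈ Subset n ] τ ⊆ block j × nullity M τ ≡ k j × ∣ τ ∣ ≡ dk j
    piece j = proj₁ (weights j)
    σ : Subset n
    σ = glue (proj₁ ∘ piece)
    σ∩B≡piece : ∀ j → σ ∩ block j ≡ proj₁ (piece j)
    σ∩B≡piece = glue-∩-block (proj₁ ∘ proj₂ ∘ piece)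
    nullσ≡i : nullity M σ ≡ i
    nullσ≡i = begin
      nullity M σ                        ≡⟨ nullity-additive σ ⟩
      ∑ (λ j → nullity M (σ ∩ block j))  ≡⟨ ∑-cong (λ j → trans (cong (nullity M) (σ∩B≡piece j))
                                                               (proj₁ (proj₂ (proj₂ (piece j))))) ⟩
      ∑ k                                ≡⟨ ∑k≡i ⟩
      i                                  ∎
    ∣σ∣≡v : ∣ σ ∣ ≡ v
    ∣σ∣≡v = begin
      ∣ σ ∣                       ≡⟨ card-additive σ ⟩
      ∑ (λ j → ∣ σ ∩ block j ∣)   ≡⟨ ∑-cong (λ j → trans (cong ∣_∣ (σ∩B≡piece j))
                                                        (proj₂ (proj₂ (proj₂ (piece j))))) ⟩
      ∑ dk                        ≡⟨ v≡∑dk ⟨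
      v                           ∎

  splitting-of-higherWeight : ∀ {i w} → IsHigherWeight M ⊤ i w → Splitting i w
  splitting-of-higherWeight {i} {w} hw@((τ , _ , nullτ≡i , ∣τ∣≡w) , _) =
    k , dk , k≤ , ∑k≡i , proj₂ ∘ optimal , ≤-antisym w≤∑dk ∑dk≤w
    where
    k : Fin t → ℕ
    k j = nullity M (τ ∩ block j)
    k≤ : ∀ j → k j ≤ nullity M (block j)
    k≤ j = nullity-mono (p∩q⊆q τ (block j))
    ∑k≡i : ∑ k ≡ i
    ∑k≡i = trans (sym (nullity-additive τ)) nullτ≡i
    optimal : ∀ j → Σ ℕ (IsHigherWeight M (block j) (k j))
    optimal j = higherWeight-exists (p∩q⊆q τ (block j)) refl
    dk : Fin t → ℕ
    dk = proj₁ ∘ optimal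
    w≤∑dk : w ≤ ∑ dk
    w≤∑dk = higherWeight≤splitting hw (k , dk , k≤ , ∑k≡i , proj₂ ∘ optimal , refl)
    ∑dk≤w : ∑ dk ≤ w
    ∑dk≤w = begin
      ∑ dk                       ≤⟨ ∑-mono-≤ (λ j → proj₂ (proj₂ (optimal j)) _ (p∩q⊆q τ (block j)) refl) ⟩
      ∑ (λ j → ∣ τ ∩ block j ∣)  ≡⟨ card-additive τ ⟨
      ∣ τ ∣                      ≡⟨ ∣τ∣≡w ⟩
      w                          ∎
      where open ≤-Reasoning

proposition3 : {n : ℕ} (M : Matroid n) (t : ℕ) (B : Blocks M t) (i : ℕ) →
    1 ≤ i → i ≤ ∣ ⊤ {n} ∣ ∸ Matroid.rk M ⊤ →
    Σ ℕ (λ w → IsHigherWeight M ⊤ i w ×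
      IsMinimum
        (λ v → Σ (Fin t → ℕ) (λ k → Σ (Fin t → ℕ) (λ dk →
          (∀ j → k j ≤ nullity M (Blocks.block B j))
          × ∑ k ≡ i
          × (∀ j → IsHigherWeight M (Blocks.block B j) (k j) (dk j))
          × v ≡ ∑ dk)))
        w)
proposition3 M t B i _ i≤nullity =
  let (τ , _ , nullτ≡i) = nullity-realised i≤nullity
      (w , hw) = higherWeight-exists ⊆⊤ nullτ≡i
  in w , hw , splitting-of-higherWeight hw , λ _ → higherWeight≤splitting hw
  where
  open MatroidProperties M
  open BlockProperties B
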